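{- For any non-empty finite subsets $A,B$ of a group $G$, $\Delta[A\cup B]\le \Delta[A]+\Delta[B]-1$.
   Context: For a subset $A$ of a group $G$, a subset $D\subseteq G$ is a difference basis for $A$ if every $a\in A$ can be written as $a=xy^{ -1}$ with $x,y\in D$. The difference size $\Delta[A]$ is the smallest cardinality of a difference basis for $A$. -}

module Defs where

open import Level using (Level; _⊔_)
open import Algebra.Bundles using (Group)
open import Data.Nat using (ℕ; _≤_)
open import Relation.Binary.PropositionalEquality using (_≡_)
open import Data.List using (List; length)
open import Data.Product using (Σ; ∃; _×_)
import Data.List.Membership.Setoid as Mem
import Data.List.Relation.Unary.Unique.Setoid as Uniq

-- Finite subsets of the group carrier are represented by lists of
-- elements; membership is up to the group's setoid equality.
module _ {c ℓ : Level} (G : Group c ℓ) where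
  open Group G
  open Mem setoid using (_∈_)
  open Uniq setoid using (Unique)

  IsDifferenceBasis : List Carrier → List Carrier → Set (c ⊔ ℓ)
  IsDifferenceBasis A D =
    ∀ a → a ∈ A → Σ Carrier λ x → Σ Carrier λ y → x ∈ D × y ∈ D × (a ≈ x ∙ y ⁻¹)

  -- A finite set given by a duplicate-free list D has cardinality length D.
  -- k is the difference size Δ[A]: the least cardinality of a difference basis.
  IsDifferenceSize : List Carrier → ℕ → Set (c ⊔ ℓ)
  IsDifferenceSize A k =
    (Σ (List Carrier) λ D → Unique D × IsDifferenceBasis A D × length D ≡ k)
    × (∀ D → Unique D → IsDifferenceBasis A D → k ≤ length D)

-- Difference bases are invariant under right translation, since
-- (x g)(y g)⁻¹ = x y⁻¹.  Given bases D of A and e ∷ E of B, translating the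
-- latter by g = e⁻¹ d for some d ∈ D sends e to d, so D ∪ E·g is a basis of
-- A ∪ B listed with |D| + |E| - 1 entries.  Discarding duplicates needs a case
-- split on membership, available only under a double negation since the
-- group's equality need not be decidable; this is harmless because the
-- conclusion is a decidable inequality of naturals.
module Submission where

open import Defs
open import Level using (Level)
open import Algebra.Bundles using (Group)
open import Data.Nat using (ℕ; _≤_; _+_; suc; s≤s; z≤n; _≤?_)
open import Data.Nat.Properties using (≤-trans; +-comm; +-suc; m≤n⇒m≤1+n; module ≤-Reasoning)
open import Data.List using (List; []; _∷_; _++_; length; map)
open import Data.List.Properties using (length-++; length-map)
open import Data.List.Relation.Unary.Any using (here; there)
open import Data.List.Relation.Unary.AllPairs using ([]; _∷_)
open import Data.Product using (∃; _×_; _,_)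
open import Data.Sum using (inj₁; inj₂)
open import Data.Empty using (⊥-elim)
open import Relation.Binary.Bundles using (Setoid)
open import Relation.Binary.PropositionalEquality using (_≡_; _≢_; refl; cong; module ≡-Reasoning)
open import Relation.Nullary using (¬_; yes; no)
open import Relation.Nullary.Decidable using (¬¬-excluded-middle; decidable-stable)
import Data.List.Membership.Setoid as Membership
import Data.List.Membership.Setoid.Properties as MembershipProperties
import Data.List.Relation.Binary.Subset.Setoid as Subset
import Data.List.Relation.Binary.Subset.Setoid.Properties as SubsetProperties
import Data.List.Relation.Unary.Unique.Setoid as Uniqueness
import Algebra.Properties.Group as GroupProperties
import Relation.Binary.Reasoning.Setoid as SetoidReasoning

module _ {a ℓ} (S : Setoid a ℓ) where
  open Setoid S using (sym)
  open Membership S using (_∈_)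
  open MembershipProperties using (∉⇒All[≉]; ∈-resp-≈; ∈-++⁻; ∈-++⁺ˡ; ∈-++⁺ʳ)
  open Subset S using (_⊆_)
  open SubsetProperties using (∷⁺ʳ; ∈-∷⁺ʳ)
  open Uniqueness S using (Unique)

  ¬¬-deduplicate : ∀ xs →
    ¬ ¬ (∃ λ ys → Unique ys × xs ⊆ ys × length ys ≤ length xs)
  ¬¬-deduplicate [] k = k ([] , [] , (λ ()) , z≤n)
  ¬¬-deduplicate (x ∷ xs) k = ¬¬-deduplicate xs λ (ys , ys! , xs⊆ys , ∣ys∣≤∣xs∣) →
    ¬¬-excluded-middle λ where
      (yes x∈ys) → k (ys , ys! , ∈-∷⁺ʳ S x∈ys xs⊆ys , m≤n⇒m≤1+n ∣ys∣≤∣xs∣)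
      (no x∉ys)  → k (x ∷ ys , ∉⇒All[≉] S x∉ys ∷ ys! , ∷⁺ʳ S x xs⊆ys , s≤s ∣ys∣≤∣xs∣)

  ++-∷-⊆-++ : ∀ {y} xs ys → y ∈ xs → xs ++ y ∷ ys ⊆ xs ++ ys
  ++-∷-⊆-++ xs ys y∈xs z∈ with ∈-++⁻ S xs z∈
  ... | inj₁ z∈xs        = ∈-++⁺ˡ S z∈xs
  ... | inj₂ (here z≈y)  = ∈-++⁺ˡ S (∈-resp-≈ S (sym z≈y) y∈xs)
  ... | inj₂ (there z∈ys) = ∈-++⁺ʳ S xs z∈ys

module _ {c ℓ} (G : Group c ℓ) where
  open Group G renaming (refl to ≈-refl)
  open GroupProperties G using (⁻¹-anti-homo-∙; \\-leftDividesˡ; //-rightDividesʳ)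
  open Membership setoid using (_∈_)
  open MembershipProperties using (∈-++⁻; ∈-++⁺ˡ; ∈-++⁺ʳ; ∈-map⁺)
  open Subset setoid using (_⊆_)

  //-rightInvariant : ∀ g x y → (x ∙ g) // (y ∙ g) ≈ x // y
  //-rightInvariant g x y = begin
    (x ∙ g) // (y ∙ g)      ≈⟨ ∙-congˡ (⁻¹-anti-homo-∙ y g) ⟩
    x ∙ g ∙ (g ⁻¹ ∙ y ⁻¹)   ≈⟨ assoc (x ∙ g) (g ⁻¹) (y ⁻¹) ⟨
    (x ∙ g // g) ∙ y ⁻¹     ≈⟨ ∙-congʳ (//-rightDividesʳ g x) ⟩
    x // y                  ∎
    where open SetoidReasoning setoid

  IsDifferenceBasis-⊆ : ∀ {A D E} → IsDifferenceBasis G A D → D ⊆ E → IsDifferenceBasis G A E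
  IsDifferenceBasis-⊆ D-basis D⊆E z z∈A =
    let x , y , x∈D , y∈D , z≈x/y = D-basis z z∈A
    in x , y , D⊆E x∈D , D⊆E y∈D , z≈x/y

  IsDifferenceBasis-++ : ∀ {A B D E} → IsDifferenceBasis G A D → IsDifferenceBasis G B E →
                         IsDifferenceBasis G (A ++ B) (D ++ E)
  IsDifferenceBasis-++ {A} {D = D} D-basis E-basis z z∈A++B with ∈-++⁻ setoid A z∈A++B
  ... | inj₁ z∈A = IsDifferenceBasis-⊆ D-basis (∈-++⁺ˡ setoid) z z∈A
  ... | inj₂ z∈B = IsDifferenceBasis-⊆ E-basis (∈-++⁺ʳ setoid D) z z∈B

  IsDifferenceBasis-nonEmpty : ∀ {A D} → A ≢ [] → IsDifferenceBasis G A D → D ≢ []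
  IsDifferenceBasis-nonEmpty {[]}    A≢[] _       = ⊥-elim (A≢[] refl)
  IsDifferenceBasis-nonEmpty {z ∷ _} _    D-basis refl with D-basis z (here ≈-refl)
  ... | _ , _ , () , _

  IsDifferenceBasis-map-∙ʳ : ∀ {A D} g → IsDifferenceBasis G A D →
                             IsDifferenceBasis G A (map (_∙ g) D)
  IsDifferenceBasis-map-∙ʳ g D-basis z z∈A =
    let x , y , x∈D , y∈D , z≈x/y = D-basis z z∈A
    in x ∙ g , y ∙ g , ∈-map⁺ setoid setoid ∙-congʳ x∈D , ∈-map⁺ setoid setoid ∙-congʳ y∈D ,
       trans z≈x/y (sym (//-rightInvariant g x y))

  IsDifferenceBasis-++-glued : ∀ {A B d D e E} →
    IsDifferenceBasis G A (d ∷ D) → IsDifferenceBasis G B (e ∷ E) →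
    IsDifferenceBasis G (A ++ B) ((d ∷ D) ++ map (_∙ (e \\ d)) E)
  IsDifferenceBasis-++-glued {d = d} {D} {e} {E} dD-basis eE-basis =
    IsDifferenceBasis-⊆
      (IsDifferenceBasis-++ dD-basis (IsDifferenceBasis-map-∙ʳ (e \\ d) eE-basis))
      (++-∷-⊆-++ setoid (d ∷ D) (map (_∙ (e \\ d)) E) (here (\\-leftDividesˡ e d)))

  IsDifferenceBasis-++-shared : ∀ {A B D E} → A ≢ [] → B ≢ [] →
    IsDifferenceBasis G A D → IsDifferenceBasis G B E →
    ∃ λ F → IsDifferenceBasis G (A ++ B) F × length D + length E ≡ suc (length F)
  IsDifferenceBasis-++-shared {D = []} A≢[] _ D-basis _ =
    ⊥-elim (IsDifferenceBasis-nonEmpty A≢[] D-basis refl)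
  IsDifferenceBasis-++-shared {D = _ ∷ _} {E = []} _ B≢[] _ E-basis =
    ⊥-elim (IsDifferenceBasis-nonEmpty B≢[] E-basis refl)
  IsDifferenceBasis-++-shared {D = d ∷ D} {E = e ∷ E} _ _ dD-basis eE-basis =
    (d ∷ D) ++ map (_∙ (e \\ d)) E , IsDifferenceBasis-++-glued dD-basis eE-basis , count
    where
    open ≡-Reasoning
    count : suc (length D) + suc (length E) ≡ suc (length ((d ∷ D) ++ map (_∙ (e \\ d)) E))
    count = begin
      suc (length D + suc (length E))                       ≡⟨ cong suc (+-suc (length D) (length E)) ⟩
      suc (suc (length D + length E))                       ≡⟨ cong (λ n → suc (suc (length D + n))) (length-map _ E) ⟨
      suc (suc (length D + length (map (_∙ (e \\ d)) E)))   ≡⟨ cong (λ n → suc (suc n)) (length-++ D) ⟨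
      suc (length ((d ∷ D) ++ map (_∙ (e \\ d)) E))         ∎

  IsDifferenceSize-≤-length : ∀ {A u F} → IsDifferenceSize G A u →
                              IsDifferenceBasis G A F → u ≤ length F
  IsDifferenceSize-≤-length {u = u} {F} (_ , minimal) F-basis =
    decidable-stable (u ≤? length F) λ u≰∣F∣ →
      ¬¬-deduplicate setoid F λ (F′ , F′! , F⊆F′ , ∣F′∣≤∣F∣) →
        u≰∣F∣ (≤-trans (minimal F′ F′! (IsDifferenceBasis-⊆ F-basis F⊆F′)) ∣F′∣≤∣F∣)

proposition4p1 : {c ℓ : Level} (G : Group c ℓ) (A B : List (Group.Carrier G)) →
    A ≢ [] → B ≢ [] → (a b u : ℕ) →
    IsDifferenceSize G A a → IsDifferenceSize G B b → IsDifferenceSize G (A ++ B) u →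
    u + 1 ≤ a + b
proposition4p1 G A B A≢[] B≢[] _ _ u ((D , _ , D-basis , refl) , _) ((E , _ , E-basis , refl) , _) u-size
  with IsDifferenceBasis-++-shared G A≢[] B≢[] D-basis E-basis
... | F , F-basis , ∣D∣+∣E∣≡1+∣F∣ = begin
  u + 1                ≡⟨ +-comm u 1 ⟩
  suc u                ≤⟨ s≤s (IsDifferenceSize-≤-length G u-size F-basis) ⟩
  suc (length F)       ≡⟨ ∣D∣+∣E∣≡1+∣F∣ ⟨
  length D + length E  ∎
  where open ≤-Reasoning
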